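{- Let $G$ be a graph and $I$ a critical independent set of $G$. Then $I=\ker(G)$ if and only if $|S|<|N(S)\cap I|$ for every nonempty $S\subseteq N(I)$.
   Context: All graphs are finite and simple. For $S\subseteq V(G)$, $N(S)$ is the set of vertices adjacent to some vertex of $S$. Let $d(G)=\max\{|S|-|N(S)|: S\subseteq V(G)\}$. A critical independent set is an independent set $S$ with $|S|-|N(S)|=d(G)$. $\ker(G)$ is the intersection of all critical independent sets of $G$. -}

module Defs where

open import Data.Nat using (ℕ; zero; suc)
open import Data.Bool using (Bool; true; false; _∧_; _∨_)
open import Data.Fin using (Fin)
open import Data.Fin.Subset using (Subset; _∈_; ∣_∣)
open import Data.Vec using (lookup; tabulate)
open import Data.Integer using (ℤ; +_; _-_; _≤_)
open import Data.Product using (_×_)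
open import Relation.Binary.PropositionalEquality using (_≡_)

record Graph : Set where
  field
    n     : ℕ
    adj   : Fin n → Fin n → Bool
    sym   : ∀ u v → adj u v ≡ adj v u
    irrefl : ∀ v → adj v v ≡ false
open Graph public

anyFin : ∀ {m} → (Fin m → Bool) → Bool
anyFin {zero}  f = false
anyFin {suc m} f = f Fin.zero ∨ anyFin (λ i → f (Fin.suc i))

N : (G : Graph) → Subset (n G) → Subset (n G)
N G S = tabulate (λ v → anyFin (λ u → lookup S u ∧ adj G u v))

excess : (G : Graph) → Subset (n G) → ℤ
excess G S = + ∣ S ∣ - + ∣ N G S ∣

Independent : (G : Graph) → Subset (n G) → Set
Independent G S = ∀ u v → u ∈ S → v ∈ S → adj G u v ≡ false

-- d(G) = max over S of |S| - |N(S)|; "excess G S = d(G)" is stated as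
-- S attaining the maximum.
AttainsD : (G : Graph) → Subset (n G) → Set
AttainsD G S = ∀ T → excess G T ≤ excess G S

CriticalIndependent : (G : Graph) → Subset (n G) → Set
CriticalIndependent G S = Independent G S × AttainsD G S

InKer : (G : Graph) → Fin (n G) → Set
InKer G x = ∀ S → CriticalIndependent G S → x ∈ S

{-# OPTIONS --safe #-}
-- Since |N| is submodular, the excess |S| - |N(S)| is supermodular, so the
-- intersection of two critical sets is again critical.  Given a critical
-- independent I and another critical J, put K = I ∩ J and S = N(I) - N(K):
-- no vertex of K has a neighbour in S, so N(S) ∩ I ⊆ I - K, while comparing
-- the excesses of I and K gives |I - K| ≤ |S|.  A vertex of I outside J makes
-- S nonempty, and the strict Hall condition |S| < |N(S) ∩ I| fails.
-- Conversely, if a nonempty S ⊆ N(I) has |N(S) ∩ I| ≤ |S|, then removing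
-- N(S) from I does not lower the excess, because the neighbourhood of the
-- remaining set misses S; this critical set omits a vertex of I adjacent to S,
-- so I is not the kernel.

module Submission where

open import Defs hiding (sym)
open import Data.Bool using (Bool; true; false; _∧_; _∨_)
open import Data.Bool.Properties using (∨-zeroʳ; ∧-conicalˡ; ∧-conicalʳ)
open import Data.Fin using (Fin; zero; suc)
open import Data.Fin.Subset
  using (Subset; _∈_; _∉_; _⊆_; _∩_; _∪_; _─_; ∣_∣; Nonempty; inside; outside)
open import Data.Fin.Subset.Properties
  using (_∈?_; nonempty?; Empty-unique; ∣⊥∣≡0; p⊆q⇒∣p∣≤∣q∣; ∩-comm; p∩q⊆p; p∩q⊆q;
         x∈p∩q⁺; x∈p∩q⁻; x∈p∪q⁺; x∈p∪q⁻; ∣p∩q∣≤∣q∣; x∈p∧x∉q⇒x∈p─q; p─q⊆p;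
         x∈p⇒∣p-x∣<∣p∣)
open import Data.Integer as ℤ using (ℤ; +_; 0ℤ)
import Data.Integer.Properties as ℤ
open import Data.Integer.Tactic.RingSolver using (solve-∀)
open import Data.Nat using (suc; _+_; _≤_; _<_; z≤n)
import Data.Nat.Properties as ℕ
open import Data.Product using (_×_; _,_; ∃-syntax)
open import Data.Sum using (inj₁; inj₂)
open import Data.Vec using ([]; _∷_; lookup; there)
open import Data.Vec.Properties using (lookup∘tabulate; []=⇒lookup; lookup⇒[]=)
open import Function.Base using (_∘_)
open import Function.Bundles using (_⇔_; mk⇔; Equivalence)
open import Relation.Binary.PropositionalEquality
  using (_≡_; refl; sym; trans; cong; cong₂)
open import Relation.Nullary using (¬_; yes; no; contradiction)

∣p∪q∣+∣p∩q∣≡∣p∣+∣q∣ : ∀ {m} (p q : Subset m) → ∣ p ∪ q ∣ + ∣ p ∩ q ∣ ≡ ∣ p ∣ + ∣ q ∣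
∣p∪q∣+∣p∩q∣≡∣p∣+∣q∣ []            []            = refl
∣p∪q∣+∣p∩q∣≡∣p∣+∣q∣ (inside  ∷ p) (inside  ∷ q) = cong suc (trans (ℕ.+-suc _ _)
  (trans (cong suc (∣p∪q∣+∣p∩q∣≡∣p∣+∣q∣ p q)) (sym (ℕ.+-suc _ _))))
∣p∪q∣+∣p∩q∣≡∣p∣+∣q∣ (inside  ∷ p) (outside ∷ q) =
  cong suc (∣p∪q∣+∣p∩q∣≡∣p∣+∣q∣ p q)
∣p∪q∣+∣p∩q∣≡∣p∣+∣q∣ (outside ∷ p) (inside  ∷ q) =
  trans (cong suc (∣p∪q∣+∣p∩q∣≡∣p∣+∣q∣ p q)) (sym (ℕ.+-suc _ _))
∣p∪q∣+∣p∩q∣≡∣p∣+∣q∣ (outside ∷ p) (outside ∷ q) = ∣p∪q∣+∣p∩q∣≡∣p∣+∣q∣ p q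

∣p∣≡∣p∩q∣+∣p─q∣ : ∀ {m} (p q : Subset m) → ∣ p ∣ ≡ ∣ p ∩ q ∣ + ∣ p ─ q ∣
∣p∣≡∣p∩q∣+∣p─q∣ []            []            = refl
∣p∣≡∣p∩q∣+∣p─q∣ (inside  ∷ p) (inside  ∷ q) = cong suc (∣p∣≡∣p∩q∣+∣p─q∣ p q)
∣p∣≡∣p∩q∣+∣p─q∣ (inside  ∷ p) (outside ∷ q) =
  trans (cong suc (∣p∣≡∣p∩q∣+∣p─q∣ p q)) (sym (ℕ.+-suc _ _))
∣p∣≡∣p∩q∣+∣p─q∣ (outside ∷ p) (inside  ∷ q) = ∣p∣≡∣p∩q∣+∣p─q∣ p q
∣p∣≡∣p∩q∣+∣p─q∣ (outside ∷ p) (outside ∷ q) = ∣p∣≡∣p∩q∣+∣p─q∣ p q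

x∈p─q⇒x∉q : ∀ {m} {x : Fin m} {p q : Subset m} → x ∈ p ─ q → x ∉ q
x∈p─q⇒x∉q {p = _ ∷ _} {q = _ ∷ _} (there x∈p─q) (there x∈q) = x∈p─q⇒x∉q x∈p─q x∈q

0<∣p∣⇒Nonempty : ∀ {m} {p : Subset m} → 0 < ∣ p ∣ → Nonempty p
0<∣p∣⇒Nonempty {m} {p} 0<∣p∣ with nonempty? p
... | yes p≢∅ = p≢∅
... | no  p≡∅ = contradiction (trans (cong ∣_∣ (Empty-unique p≡∅)) (∣⊥∣≡0 m)) (ℕ.>⇒≢ 0<∣p∣)

anyFin-sound : ∀ {m} (f : Fin m → Bool) → anyFin f ≡ true → ∃[ i ] f i ≡ true
anyFin-sound {suc m} f any-f with f zero in f0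
... | true  = zero , f0
... | false with anyFin-sound (f ∘ suc) any-f
...   | i , fi = suc i , fi

anyFin-complete : ∀ {m} (f : Fin m → Bool) {i} → f i ≡ true → anyFin f ≡ true
anyFin-complete f {zero}  fi = cong (_∨ anyFin (f ∘ suc)) fi
anyFin-complete f {suc i} fi =
  trans (cong (f zero ∨_) (anyFin-complete (f ∘ suc) fi)) (∨-zeroʳ (f zero))

+-cancelˡ-≤ : ∀ i {j k} → i ℤ.+ j ℤ.≤ i ℤ.+ k → j ℤ.≤ k
+-cancelˡ-≤ i i+j≤i+k = ℤ.≮⇒≥ (λ k<j → ℤ.<⇒≱ (ℤ.+-monoʳ-< i k<j) i+j≤i+k)

pos-+-minus-interchange : ∀ a b c d →
  + (a + b) ℤ.- + (c + d) ≡ (+ a ℤ.- + c) ℤ.+ (+ b ℤ.- + d)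
pos-+-minus-interchange a b c d = trans
  (cong₂ ℤ._-_ (ℤ.pos-+ a b) (ℤ.pos-+ c d))
  (interchange (+ a) (+ b) (+ c) (+ d))
  where
  interchange : ∀ x y z w → (x ℤ.+ y) ℤ.- (z ℤ.+ w) ≡ (x ℤ.- z) ℤ.+ (y ℤ.- w)
  interchange = solve-∀

module _ (G : Graph) where

  ∈N⁻ : ∀ {S v} → v ∈ N G S → ∃[ u ] (u ∈ S × adj G u v ≡ true)
  ∈N⁻ {S} {v} v∈NS with anyFin-sound _ (trans (sym (lookup∘tabulate _ v)) ([]=⇒lookup v∈NS))
  ... | u , Su∧uv = u , lookup⇒[]= u S (∧-conicalˡ _ _ Su∧uv) , ∧-conicalʳ _ _ Su∧uv

  ∈N⁺ : ∀ {S u v} → u ∈ S → adj G u v ≡ true → v ∈ N G S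
  ∈N⁺ {S} {u} {v} u∈S uv = lookup⇒[]= v (N G S) (trans (lookup∘tabulate _ v)
    (anyFin-complete (λ w → lookup S w ∧ adj G w v) (cong₂ _∧_ ([]=⇒lookup u∈S) uv)))

  N-mono : ∀ {S T} → S ⊆ T → N G S ⊆ N G T
  N-mono S⊆T v∈NS with ∈N⁻ v∈NS
  ... | u , u∈S , uv = ∈N⁺ (S⊆T u∈S) uv

  N-∪ : ∀ S T → N G (S ∪ T) ⊆ N G S ∪ N G T
  N-∪ S T v∈N[S∪T] with ∈N⁻ v∈N[S∪T]
  ... | u , u∈S∪T , uv with x∈p∪q⁻ S T u∈S∪T
  ...   | inj₁ u∈S = x∈p∪q⁺ (inj₁ (∈N⁺ u∈S uv))
  ...   | inj₂ u∈T = x∈p∪q⁺ (inj₂ (∈N⁺ u∈T uv))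

  N-∩ : ∀ S T → N G (S ∩ T) ⊆ N G S ∩ N G T
  N-∩ S T v∈N[S∩T] = x∈p∩q⁺ (N-mono (p∩q⊆p S T) v∈N[S∩T] , N-mono (p∩q⊆q S T) v∈N[S∩T])

  ∈N-swap : ∀ {S T v} → v ∈ N G S → v ∈ T → ∃[ u ] (u ∈ S × u ∈ N G T)
  ∈N-swap v∈NS v∈T with ∈N⁻ v∈NS
  ... | u , u∈S , uv = u , u∈S , ∈N⁺ v∈T (trans (Graph.sym G _ _) uv)

  N[S─NT]∩T≡∅ : ∀ S T {v} → v ∈ N G (S ─ N G T) → v ∉ T
  N[S─NT]∩T≡∅ S T v∈N[S─NT] v∈T with ∈N-swap {S ─ N G T} v∈N[S─NT] v∈T
  ... | u , u∈S─NT , u∈NT = x∈p─q⇒x∉q u∈S─NT u∈NT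

  ∣N∣-submodular : ∀ S T → ∣ N G (S ∪ T) ∣ + ∣ N G (S ∩ T) ∣ ≤ ∣ N G S ∣ + ∣ N G T ∣
  ∣N∣-submodular S T = begin
    ∣ N G (S ∪ T) ∣ + ∣ N G (S ∩ T) ∣
      ≤⟨ ℕ.+-mono-≤ (p⊆q⇒∣p∣≤∣q∣ (N-∪ S T)) (p⊆q⇒∣p∣≤∣q∣ (N-∩ S T)) ⟩
    ∣ N G S ∪ N G T ∣ + ∣ N G S ∩ N G T ∣
      ≡⟨ ∣p∪q∣+∣p∩q∣≡∣p∣+∣q∣ (N G S) (N G T) ⟩
    ∣ N G S ∣ + ∣ N G T ∣ ∎
    where open ℕ.≤-Reasoning

  excess-supermodular : ∀ S T →
    excess G S ℤ.+ excess G T ℤ.≤ excess G (S ∪ T) ℤ.+ excess G (S ∩ T)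
  excess-supermodular S T = begin
    excess G S ℤ.+ excess G T
      ≡⟨ sym (pos-+-minus-interchange (∣ S ∣) (∣ T ∣) (∣ N G S ∣) (∣ N G T ∣)) ⟩
    (+ (∣ S ∣ + ∣ T ∣)) ℤ.- (+ (∣ N G S ∣ + ∣ N G T ∣))
      ≡⟨ cong (λ k → + k ℤ.- + (∣ N G S ∣ + ∣ N G T ∣))
              (sym (∣p∪q∣+∣p∩q∣≡∣p∣+∣q∣ S T)) ⟩
    (+ (∣ S ∪ T ∣ + ∣ S ∩ T ∣)) ℤ.- (+ (∣ N G S ∣ + ∣ N G T ∣))
      ≤⟨ ℤ.+-monoʳ-≤ (+ (∣ S ∪ T ∣ + ∣ S ∩ T ∣))
                     (ℤ.neg-mono-≤ (ℤ.+≤+ (∣N∣-submodular S T))) ⟩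
    (+ (∣ S ∪ T ∣ + ∣ S ∩ T ∣)) ℤ.- (+ (∣ N G (S ∪ T) ∣ + ∣ N G (S ∩ T) ∣))
      ≡⟨ pos-+-minus-interchange
           (∣ S ∪ T ∣) (∣ S ∩ T ∣) (∣ N G (S ∪ T) ∣) (∣ N G (S ∩ T) ∣) ⟩
    excess G (S ∪ T) ℤ.+ excess G (S ∩ T) ∎
    where open ℤ.≤-Reasoning

  AttainsD-∩ : ∀ I J → AttainsD G I → AttainsD G J → AttainsD G (I ∩ J)
  AttainsD-∩ I J attains-I attains-J T = ℤ.≤-trans (attains-I T) excess-I≤excess-I∩J
    where
    open ℤ.≤-Reasoning
    excess-I≤excess-I∩J : excess G I ℤ.≤ excess G (I ∩ J)
    excess-I≤excess-I∩J = +-cancelˡ-≤ (excess G J) (begin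
      excess G J ℤ.+ excess G I
        ≡⟨ ℤ.+-comm (excess G J) (excess G I) ⟩
      excess G I ℤ.+ excess G J
        ≤⟨ excess-supermodular I J ⟩
      excess G (I ∪ J) ℤ.+ excess G (I ∩ J)
        ≤⟨ ℤ.+-monoˡ-≤ (excess G (I ∩ J)) (attains-J (I ∪ J)) ⟩
      excess G J ℤ.+ excess G (I ∩ J) ∎)

  excess≤excess-─N : ∀ {I S} → S ⊆ N G I → ∣ N G S ∩ I ∣ ≤ ∣ S ∣ →
    excess G I ℤ.≤ excess G (I ─ N G S)
  excess≤excess-─N {I} {S} S⊆NI ∣NS∩I∣≤∣S∣ = begin
    excess G I
      ≡⟨ cong₂ (λ a b → + a ℤ.- + b) (∣p∣≡∣p∩q∣+∣p─q∣ I (N G S))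
                                     (∣p∣≡∣p∩q∣+∣p─q∣ (N G I) S) ⟩
    (+ (∣ I ∩ N G S ∣ + ∣ I ─ N G S ∣)) ℤ.- (+ (∣ N G I ∩ S ∣ + ∣ N G I ─ S ∣))
      ≡⟨ pos-+-minus-interchange
           (∣ I ∩ N G S ∣) (∣ I ─ N G S ∣) (∣ N G I ∩ S ∣) (∣ N G I ─ S ∣) ⟩
    (+ ∣ I ∩ N G S ∣ ℤ.- + ∣ N G I ∩ S ∣) ℤ.+ (+ ∣ I ─ N G S ∣ ℤ.- + ∣ N G I ─ S ∣)
      ≤⟨ ℤ.+-mono-≤ (ℤ.i≤j⇒i-j≤0 (ℤ.+≤+ ∣I∩NS∣≤∣NI∩S∣))
                    (ℤ.+-monoʳ-≤ (+ ∣ I ─ N G S ∣)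
                                 (ℤ.neg-mono-≤ (ℤ.+≤+ (p⊆q⇒∣p∣≤∣q∣ N[I─NS]⊆NI─S)))) ⟩
    0ℤ ℤ.+ excess G (I ─ N G S)
      ≡⟨ ℤ.+-identityˡ (excess G (I ─ N G S)) ⟩
    excess G (I ─ N G S) ∎
    where
    open ℤ.≤-Reasoning
    ∣I∩NS∣≤∣NI∩S∣ : ∣ I ∩ N G S ∣ ≤ ∣ N G I ∩ S ∣
    ∣I∩NS∣≤∣NI∩S∣ = ℕ.≤-trans (ℕ.≤-reflexive (cong ∣_∣ (∩-comm I (N G S))))
      (ℕ.≤-trans ∣NS∩I∣≤∣S∣ (p⊆q⇒∣p∣≤∣q∣ (λ x∈S → x∈p∩q⁺ (S⊆NI x∈S , x∈S))))
    N[I─NS]⊆NI─S : N G (I ─ N G S) ⊆ N G I ─ S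
    N[I─NS]⊆NI─S v∈N[I─NS] =
      x∈p∧x∉q⇒x∈p─q (N-mono (p─q⊆p I (N G S)) v∈N[I─NS]) (N[S─NT]∩T≡∅ I S v∈N[I─NS])

  excess-≤⇒∣I─K∣≤∣NI─NK∣ : ∀ {I K} → K ⊆ I → excess G I ℤ.≤ excess G K →
    ∣ I ─ K ∣ ≤ ∣ N G I ─ N G K ∣
  excess-≤⇒∣I─K∣≤∣NI─NK∣ {I} {K} K⊆I excess-I≤excess-K =
    ℤ.drop‿+≤+ (ℤ.i-j≤0⇒i≤j (+-cancelˡ-≤ common (begin
      common ℤ.+ (+ ∣ I ─ K ∣ ℤ.- + ∣ N G I ─ N G K ∣)
        ≡⟨ sym (pos-+-minus-interchange
                 (∣ I ∩ K ∣) (∣ I ─ K ∣) (∣ N G I ∩ N G K ∣) (∣ N G I ─ N G K ∣)) ⟩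
      (+ (∣ I ∩ K ∣ + ∣ I ─ K ∣)) ℤ.- (+ (∣ N G I ∩ N G K ∣ + ∣ N G I ─ N G K ∣))
        ≡⟨ sym (cong₂ (λ a b → + a ℤ.- + b) (∣p∣≡∣p∩q∣+∣p─q∣ I K)
                                            (∣p∣≡∣p∩q∣+∣p─q∣ (N G I) (N G K))) ⟩
      excess G I
        ≤⟨ excess-I≤excess-K ⟩
      excess G K
        ≤⟨ ℤ.+-mono-≤ (ℤ.+≤+ (p⊆q⇒∣p∣≤∣q∣ (λ x∈K → x∈p∩q⁺ (K⊆I x∈K , x∈K))))
                      (ℤ.neg-mono-≤ (ℤ.+≤+ (∣p∩q∣≤∣q∣ (N G I) (N G K)))) ⟩
      common
        ≡⟨ sym (ℤ.+-identityʳ common) ⟩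
      common ℤ.+ 0ℤ ∎)))
    where
    open ℤ.≤-Reasoning
    common : ℤ
    common = + ∣ I ∩ K ∣ ℤ.- + ∣ N G I ∩ N G K ∣

  CriticalIndependent-⊆ : ∀ {I K} → CriticalIndependent G I → K ⊆ I →
    excess G I ℤ.≤ excess G K → CriticalIndependent G K
  CriticalIndependent-⊆ (independent , attains) K⊆I excess-I≤excess-K =
    (λ u v u∈K v∈K → independent u v (K⊆I u∈K) (K⊆I v∈K)) ,
    (λ T → ℤ.≤-trans (attains T) excess-I≤excess-K)

  StrictHall : Subset (n G) → Set
  StrictHall I = ∀ S → S ⊆ N G I → Nonempty S → ∣ S ∣ < ∣ N G S ∩ I ∣

  StrictHall⇒excess-≤⇒⊇ : ∀ {I K} → StrictHall I → K ⊆ I →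
    excess G I ℤ.≤ excess G K → I ⊆ K
  StrictHall⇒excess-≤⇒⊇ {I} {K} hall K⊆I excess-I≤excess-K {x} x∈I with x ∈? K
  ... | yes x∈K = x∈K
  ... | no  x∉K = contradiction (ℕ.≤-trans (p⊆q⇒∣p∣≤∣q∣ N[S]∩I⊆I─K) ∣I─K∣≤∣S∣)
                                (ℕ.<⇒≱ (hall S (p─q⊆p (N G I) (N G K)) S-nonempty))
    where
    S : Subset (n G)
    S = N G I ─ N G K
    ∣I─K∣≤∣S∣ : ∣ I ─ K ∣ ≤ ∣ S ∣
    ∣I─K∣≤∣S∣ = excess-≤⇒∣I─K∣≤∣NI─NK∣ K⊆I excess-I≤excess-K
    S-nonempty : Nonempty S
    S-nonempty = 0<∣p∣⇒Nonempty (ℕ.<-≤-trans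
      (ℕ.≤-<-trans z≤n (x∈p⇒∣p-x∣<∣p∣ (x∈p∧x∉q⇒x∈p─q x∈I x∉K))) ∣I─K∣≤∣S∣)
    N[S]∩I⊆I─K : N G S ∩ I ⊆ I ─ K
    N[S]∩I⊆I─K v∈N[S]∩I with x∈p∩q⁻ (N G S) I v∈N[S]∩I
    ... | v∈NS , v∈I = x∈p∧x∉q⇒x∈p─q v∈I (N[S─NT]∩T≡∅ (N G I) K v∈NS)

  StrictHall⇒InKer : ∀ {I x} → CriticalIndependent G I → StrictHall I → x ∈ I → InKer G x
  StrictHall⇒InKer {I} (_ , attains-I) hall x∈I J (_ , attains-J) =
    p∩q⊆q I J (StrictHall⇒excess-≤⇒⊇ hall (p∩q⊆p I J)
                                      (AttainsD-∩ I J attains-I attains-J I) x∈I)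

  InKer⇒StrictHall : ∀ {I} → CriticalIndependent G I →
    (∀ {x} → x ∈ I → InKer G x) → StrictHall I
  InKer⇒StrictHall {I} critical I⊆ker S S⊆NI (s , s∈S) = ℕ.≰⇒> ∣NS∩I∣≰∣S∣
    where
    ∣NS∩I∣≰∣S∣ : ¬ ∣ N G S ∩ I ∣ ≤ ∣ S ∣
    ∣NS∩I∣≰∣S∣ ∣NS∩I∣≤∣S∣ with ∈N-swap (S⊆NI s∈S) s∈S
    ... | u , u∈I , u∈NS = x∈p─q⇒x∉q (I⊆ker u∈I (I ─ N G S) critical-I─NS) u∈NS
      where
      critical-I─NS : CriticalIndependent G (I ─ N G S)
      critical-I─NS = CriticalIndependent-⊆ critical (p─q⊆p I (N G S))
                                            (excess≤excess-─N S⊆NI ∣NS∩I∣≤∣S∣)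

mainTheorem16 : (G : Graph) (I : Subset (n G)) → CriticalIndependent G I →
    ((∀ x → (x ∈ I) ⇔ InKer G x) ⇔
     (∀ S → S ⊆ N G I → Nonempty S → ∣ S ∣ < ∣ N G S ∩ I ∣))
mainTheorem16 G I critical = mk⇔
  (λ I⇔ker → InKer⇒StrictHall G critical (λ {x} → Equivalence.to (I⇔ker x)))
  (λ hall x → mk⇔ (StrictHall⇒InKer G critical hall) (λ x∈ker → x∈ker I critical))
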